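{- Let $f(x,y) = k_0x^n + k_1x^{n-1}y + \cdots + k_{n-1}xy^{n-1} + k_ny^n$ be a homogeneous polynomial of degree $n \ge 1$ with integer coefficients $k_i$ and $k_n \neq 0$. Let $a$ and $b$ be nonzero integers such that $\gcd(k_n, a) = 1$ and $a^m$ divides $f(a,b)$ for some integer $m \ge n$. Then $a$ divides $b$. -}

module Defs where

open import Data.Nat using (ℕ; zero; suc; _∸_)
open import Data.Fin using (Fin; toℕ)
import Data.Fin as Fin
open import Data.Integer using (ℤ; _+_; _*_; _^_; 0ℤ)

sumℤ : (m : ℕ) → (Fin m → ℤ) → ℤ
sumℤ zero    g = 0ℤ
sumℤ (suc m) g = g Fin.zero + sumℤ m (λ i → g (Fin.suc i))

binaryForm : (n : ℕ) → (Fin (suc n) → ℤ) → ℤ → ℤ → ℤ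
binaryForm n k x y = sumℤ (suc n) (λ i → k i * (x ^ (n ∸ toℕ i)) * (y ^ toℕ i))

{-# OPTIONS --safe #-}

-- Write a = a′d and b = b′d with d = gcd a b, so that a′ and b′ are coprime.
-- By homogeneity f(a,b) = dⁿ f(a′,b′), hence aⁿ ∣ f(a,b) gives a′ⁿ ∣ f(a′,b′).
-- Modulo a′ every monomial of f(a′,b′) but kₙb′ⁿ vanishes, so a′ ∣ kₙb′ⁿ; as a′
-- is coprime to kₙ (it divides a) and to b′, a′ is a unit, and a ∣ d ∣ b.
module Submission where

open import Defs
open import Data.Nat using (ℕ; suc; _≥_)
open import Data.Fin using (Fin; fromℕ)
open import Data.Integer using (ℤ; _^_; 0ℤ; +_)
open import Data.Integer.Divisibility using (_∣_)
open import Data.Integer.GCD using (gcd)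
open import Relation.Binary.PropositionalEquality using (_≡_; _≢_)

open import Data.Nat using (zero; _∸_; _<_; _≤_; z<s; s≤s; s≤s⁻¹)
import Data.Nat as ℕ using (_+_)
open import Data.Nat.Properties using (m<n⇒0<n∸m; m∸n+n≡m; m+[n∸m]≡n; n∸n≡0)
import Data.Nat.Divisibility as ℕ
import Data.Nat.Coprimality as ℕ
open import Data.Fin using (toℕ; inject₁) renaming (zero to fzero; suc to fsuc)
open import Data.Fin.Properties using (toℕ-fromℕ; toℕ<n; inject₁ℕ<)
open import Data.Integer using (_+_; _*_; 1ℤ; ≢-nonZero)
open import Data.Integer.Properties
  using (+-comm; +-assoc; *-comm; *-zeroʳ; *-identityˡ; *-identityʳ; *-distribˡ-+;
         ^-distribˡ-+-*; i^n≡0⇒i≡0; +-injective)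
-- The argument uses signed divisibility, which carries its quotient; the statement's
-- unsigned ∣ (divisibility of absolute values) is converted only at the boundary.
import Data.Integer.Divisibility.Signed as Signed
open Signed
  using (divides; ∣ᵤ⇒∣; ∣⇒∣ᵤ; ∣-refl; ∣-trans; ∣m⇒∣m*n; ∣n⇒∣m*n; ∣m∣n⇒∣m+n; ∣m+n∣m⇒∣n;
         *-monoˡ-∣; *-cancelˡ-∣; *-cancelʳ-∣)
open import Data.Integer.Coprimality using (Coprime; coprime-divisor)
open import Data.Integer.GCD using (gcd[i,j]∣i; gcd[i,j]∣j; gcd-greatest; gcd[i,j]≡0⇒i≡0)
open import Data.Integer.Tactic.RingSolver using (solve-∀)
open import Data.Product using (∃₂; _×_; _,_)
open import Function using (_∘_)
open import Relation.Binary.PropositionalEquality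
  using (refl; sym; trans; cong; cong₂; subst; subst₂; module ≡-Reasoning)

sumℤ-cong : ∀ m {g h : Fin m → ℤ} → (∀ i → g i ≡ h i) → sumℤ m g ≡ sumℤ m h
sumℤ-cong zero    g≗h = refl
sumℤ-cong (suc m) g≗h = cong₂ _+_ (g≗h fzero) (sumℤ-cong m (g≗h ∘ fsuc))

*-distribˡ-sumℤ : ∀ c m (g : Fin m → ℤ) → c * sumℤ m g ≡ sumℤ m (λ i → c * g i)
*-distribˡ-sumℤ c zero    g = *-zeroʳ c
*-distribˡ-sumℤ c (suc m) g =
  trans (*-distribˡ-+ c _ _) (cong (λ s → c * g fzero + s) (*-distribˡ-sumℤ c m (g ∘ fsuc)))

sumℤ-init-last : ∀ m (g : Fin (suc m) → ℤ) → sumℤ (suc m) g ≡ sumℤ m (g ∘ inject₁) + g (fromℕ m)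
sumℤ-init-last zero    g = +-comm (g fzero) 0ℤ
sumℤ-init-last (suc m) g =
  trans (cong (λ s → g fzero + s) (sumℤ-init-last m (g ∘ fsuc))) (sym (+-assoc (g fzero) _ _))

∣-sumℤ : ∀ {x} m {g : Fin m → ℤ} → (∀ i → x Signed.∣ g i) → x Signed.∣ sumℤ m g
∣-sumℤ zero    x∣g = divides 0ℤ refl
∣-sumℤ (suc m) x∣g = ∣m∣n⇒∣m+n (x∣g fzero) (∣-sumℤ m (x∣g ∘ fsuc))

^-distribʳ-* : ∀ x y n → (x * y) ^ n ≡ x ^ n * y ^ n
^-distribʳ-* x y zero    = refl
^-distribʳ-* x y (suc n) =
  trans (cong (x * y *_) (^-distribʳ-* x y n)) (interchange x y (x ^ n) (y ^ n))
  where
  interchange : ∀ a b c d → a * b * (c * d) ≡ a * c * (b * d)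
  interchange = solve-∀

i∣i^n : ∀ i {n} → 0 < n → i Signed.∣ i ^ n
i∣i^n i (s≤s _) = ∣m⇒∣m*n _ ∣-refl

i^m∣i^n : ∀ i {m n} → m ≤ n → i ^ m Signed.∣ i ^ n
i^m∣i^n i {m} {n} m≤n = subst (λ e → i ^ m Signed.∣ i ^ e) (m+[n∸m]≡n m≤n)
  (subst (i ^ m Signed.∣_) (sym (^-distribˡ-+-* i m (n ∸ m))) (∣m⇒∣m*n _ ∣-refl))

monomial : (n : ℕ) → (Fin (suc n) → ℤ) → ℤ → ℤ → Fin (suc n) → ℤ
monomial n k x y i = k i * x ^ (n ∸ toℕ i) * y ^ toℕ i

binaryForm-homogeneous : ∀ n k x y d → binaryForm n k (x * d) (y * d) ≡ d ^ n * binaryForm n k x y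
binaryForm-homogeneous n k x y d =
  trans (sumℤ-cong (suc n) scaled) (sym (*-distribˡ-sumℤ (d ^ n) (suc n) (monomial n k x y)))
  where
  regroup : ∀ c X D Y E → c * (X * D) * (Y * E) ≡ D * E * (c * X * Y)
  regroup = solve-∀
  scaled : ∀ i → monomial n k (x * d) (y * d) i ≡ d ^ n * monomial n k x y i
  scaled i = begin
    k i * (x * d) ^ (n ∸ t) * (y * d) ^ t
      ≡⟨ cong₂ (λ u v → k i * u * v) (^-distribʳ-* x d (n ∸ t)) (^-distribʳ-* y d t) ⟩
    k i * (x ^ (n ∸ t) * d ^ (n ∸ t)) * (y ^ t * d ^ t)
      ≡⟨ regroup (k i) (x ^ (n ∸ t)) (d ^ (n ∸ t)) (y ^ t) (d ^ t) ⟩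
    d ^ (n ∸ t) * d ^ t * monomial n k x y i
      ≡⟨ cong (_* monomial n k x y i) (sym (^-distribˡ-+-* d (n ∸ t) t)) ⟩
    d ^ (n ∸ t ℕ.+ t) * monomial n k x y i
      ≡⟨ cong (λ e → d ^ e * monomial n k x y i) (m∸n+n≡m (s≤s⁻¹ (toℕ<n i))) ⟩
    d ^ n * monomial n k x y i ∎
    where
    open ≡-Reasoning
    t = toℕ i

∣binaryForm⇒∣lastTerm : ∀ n k {x} y → x Signed.∣ binaryForm n k x y → x Signed.∣ k (fromℕ n) * y ^ n
∣binaryForm⇒∣lastTerm n k {x} y x∣f =
  subst (x Signed.∣_) last≡ (∣m+n∣m⇒∣n x∣init+last (∣-sumℤ n x∣init))
  where
  x∣init+last : x Signed.∣ sumℤ n (monomial n k x y ∘ inject₁) + monomial n k x y (fromℕ n)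
  x∣init+last = subst (x Signed.∣_) (sumℤ-init-last n (monomial n k x y)) x∣f
  x∣init : ∀ i → x Signed.∣ monomial n k x y (inject₁ i)
  x∣init i = ∣m⇒∣m*n _ (∣n⇒∣m*n (k (inject₁ i)) (i∣i^n x (m<n⇒0<n∸m (inject₁ℕ< i))))
  last≡ : monomial n k x y (fromℕ n) ≡ k (fromℕ n) * y ^ n
  last≡ rewrite toℕ-fromℕ n | n∸n≡0 n = cong (_* y ^ n) (*-identityʳ (k (fromℕ n)))

^∣binaryForm-cancel : ∀ n k x y {d} → d ≢ 0ℤ →
  (x * d) ^ n Signed.∣ binaryForm n k (x * d) (y * d) → x ^ n Signed.∣ binaryForm n k x y
^∣binaryForm-cancel n k x y {d} d≢0 =
  *-cancelˡ-∣ (d ^ n) ∘ subst₂ Signed._∣_ (trans (^-distribʳ-* x d n) (*-comm (x ^ n) (d ^ n)))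
                                         (binaryForm-homogeneous n k x y d)
  where instance _ = ≢-nonZero (d≢0 ∘ i^n≡0⇒i≡0 d n)

coprime-∣ˡ : ∀ {x y z} → x Signed.∣ y → Coprime y z → Coprime x z
coprime-∣ˡ x∣y y⊥z (c∣x , c∣z) = y⊥z (ℕ.∣-trans c∣x (∣⇒∣ᵤ x∣y) , c∣z)

coprime-∣^⇒∣1 : ∀ x y n → Coprime x y → x Signed.∣ y ^ n → x Signed.∣ 1ℤ
coprime-∣^⇒∣1 x y zero    x⊥y x∣1     = x∣1
coprime-∣^⇒∣1 x y (suc n) x⊥y x∣y^1+n =
  coprime-∣^⇒∣1 x y n x⊥y (∣ᵤ⇒∣ (coprime-divisor x y (y ^ n) x⊥y (∣⇒∣ᵤ x∣y^1+n)))

coprime-∣binaryForm⇒∣1 : ∀ n k x y → Coprime x (k (fromℕ n)) → Coprime x y →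
  x Signed.∣ binaryForm n k x y → x Signed.∣ 1ℤ
coprime-∣binaryForm⇒∣1 n k x y x⊥kₙ x⊥y x∣f =
  coprime-∣^⇒∣1 x y n x⊥y
    (∣ᵤ⇒∣ (coprime-divisor x (k (fromℕ n)) (y ^ n) x⊥kₙ (∣⇒∣ᵤ (∣binaryForm⇒∣lastTerm n k y x∣f))))

gcd-decomposition : ∀ a b → a ≢ 0ℤ →
  ∃₂ λ a′ b′ → a ≡ a′ * gcd a b × b ≡ b′ * gcd a b × Coprime a′ b′
gcd-decomposition a b a≢0 = a′ , b′ , a≡a′d , b≡b′d , a′⊥b′
  where
  d = gcd a b
  open Signed._∣_ (∣ᵤ⇒∣ {d} {a} (gcd[i,j]∣i a b)) renaming (quotient to a′; equality to a≡a′d)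
  open Signed._∣_ (∣ᵤ⇒∣ {d} {b} (gcd[i,j]∣j a b)) renaming (quotient to b′; equality to b≡b′d)
  instance _ = ≢-nonZero (a≢0 ∘ gcd[i,j]≡0⇒i≡0 a b)
  a′⊥b′ : Coprime a′ b′
  a′⊥b′ {c} (c∣a′ , c∣b′) = ℕ.∣1⇒≡1 (∣⇒∣ᵤ (*-cancelʳ-∣ d {+ c} {1ℤ} cd∣1d))
    where
    cd∣ : ∀ {x} x′ → x ≡ x′ * d → + c ∣ x′ → + c * d Signed.∣ x
    cd∣ x′ x≡x′d c∣x′ =
      subst (+ c * d Signed.∣_) (sym x≡x′d) (*-monoˡ-∣ d (∣ᵤ⇒∣ {+ c} {x′} c∣x′))
    cd∣1d : + c * d Signed.∣ 1ℤ * d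
    cd∣1d = subst (+ c * d Signed.∣_) (sym (*-identityˡ d))
      (∣ᵤ⇒∣ (gcd-greatest {a} {b} {+ c * d} (∣⇒∣ᵤ (cd∣ a′ a≡a′d c∣a′)) (∣⇒∣ᵤ (cd∣ b′ b≡b′d c∣b′))))

lemma10 : (n : ℕ) → n ≥ 1 → (k : Fin (suc n) → ℤ) → k (fromℕ n) ≢ 0ℤ →
    (a b : ℤ) → a ≢ 0ℤ → b ≢ 0ℤ → gcd (k (fromℕ n)) a ≡ + 1 →
    (m : ℕ) → m ≥ n → (a ^ m) ∣ binaryForm n k a b → a ∣ b
lemma10 n@(suc _) _ k _ a b a≢0 _ gcd[kₙ,a]≡1 m n≤m aᵐ∣f
  with a′ , b′ , a≡a′d , b≡b′d , a′⊥b′ ← gcd-decomposition a b a≢0 =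
  ∣⇒∣ᵤ (∣-trans a∣d (∣ᵤ⇒∣ {d} {b} (gcd[i,j]∣j a b)))
  where
  d = gcd a b
  d≢0 : d ≢ 0ℤ
  d≢0 = a≢0 ∘ gcd[i,j]≡0⇒i≡0 a b
  aⁿ∣f : a ^ n Signed.∣ binaryForm n k a b
  aⁿ∣f = ∣-trans (i^m∣i^n a n≤m) (∣ᵤ⇒∣ aᵐ∣f)
  a′ⁿ∣f′ : a′ ^ n Signed.∣ binaryForm n k a′ b′
  a′ⁿ∣f′ = ^∣binaryForm-cancel n k a′ b′ d≢0
             (subst₂ (λ u v → u ^ n Signed.∣ binaryForm n k u v) a≡a′d b≡b′d aⁿ∣f)
  a′∣a : a′ Signed.∣ a
  a′∣a = subst (a′ Signed.∣_) (sym a≡a′d) (∣m⇒∣m*n d ∣-refl)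
  a′⊥kₙ : Coprime a′ (k (fromℕ n))
  a′⊥kₙ = coprime-∣ˡ {z = k (fromℕ n)} a′∣a (ℕ.sym (ℕ.gcd≡1⇒coprime (+-injective gcd[kₙ,a]≡1)))
  a′∣1 : a′ Signed.∣ 1ℤ
  a′∣1 = coprime-∣binaryForm⇒∣1 n k a′ b′ a′⊥kₙ a′⊥b′ (∣-trans (i∣i^n a′ {n} z<s) a′ⁿ∣f′)
  a∣d : a Signed.∣ d
  a∣d = subst₂ Signed._∣_ (sym a≡a′d) (*-identityˡ d) (*-monoˡ-∣ d a′∣1)
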